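{- Let $G$ be a cubic graph, let $M$ be a maximum matching of $G$, and let $D\in\mathcal{D}_G(M)$. Then $D$ is a dominating set of $G$, and each $M$-unmatched vertex is dominated by at least two vertices of $D$ (that is, has at least two neighbors in $D$).
   Context: All graphs are finite and simple; a cubic graph is one in which every vertex has degree $3$. A matching is a set of pairwise disjoint edges; a maximum matching is one of maximum cardinality. Given a matching $M$, a vertex is $M$-matched if it is incident with an edge of $M$, and $M$-unmatched otherwise. A set $D$ of vertices is dominating if every vertex outside $D$ has a neighbor in $D$. For a graph $G$ and a maximum matching $M$ of $G$, $\mathcal{D}_G(M)$ is the collection of all sets $D\subseteq V(G)$ such that: (i) for every edge $uv\in M$, if exactly one of $u$ and $v$ has an $M$-unmatched neighbor, then the vertex of $\{u,v\}$ having an $M$-unmatched neighbor belongs to $D$; (ii) for every edge $uv\in M$, if neither $u$ nor $v$ has an $M$-unmatched neighbor, or if $u$ and $v$ have a common $M$-unmatched neighbor, then exactly one of $u$ and $v$ belongs to $D$. -}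

module Defs where

open import Data.Nat using (ℕ; _<_)
open import Data.Fin using (Fin; toℕ)
open import Data.Bool using (Bool; true; false)
open import Data.List using (List; length; filter; allFin; cartesianProduct)
open import Data.Product using (Σ; ∃; ∃-syntax; _×_; _,_; proj₁; proj₂)
open import Data.Sum using (_⊎_)
open import Data.Bool.Properties using (T?)
open import Relation.Nullary using (¬_)
open import Relation.Binary.PropositionalEquality using (_≡_; _≢_)

record Graph (n : ℕ) : Set where
  field
    adj   : Fin n → Fin n → Bool
    sym   : ∀ u v → adj u v ≡ adj v u
    irref : ∀ v → adj v v ≡ false

open Graph public

countTrue : {n : ℕ} → (Fin n → Bool) → ℕ
countTrue {n} f = length (filter (λ w → T? (f w)) (allFin n))

degree : {n : ℕ} → Graph n → Fin n → ℕ
degree G v = countTrue (adj G v)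

Cubic : {n : ℕ} → Graph n → Set
Cubic G = ∀ v → degree G v ≡ 3

record IsMatching {n : ℕ} (G : Graph n) (M : Fin n → Fin n → Bool) : Set where
  field
    sub      : ∀ u v → M u v ≡ true → adj G u v ≡ true
    msym     : ∀ u v → M u v ≡ M v u
    disjoint : ∀ u v w → M u v ≡ true → M u w ≡ true → v ≡ w

-- number of edges of M: unordered pairs {u,v} counted once (toℕ u < toℕ v)
edgeCount : {n : ℕ} → (Fin n → Fin n → Bool) → ℕ
edgeCount {n} M =
  length (filter (λ p → T? (M (proj₁ p) (proj₂ p)))
                 (filter (λ p → toℕ (proj₁ p) Data.Nat.<? toℕ (proj₂ p))
                         (cartesianProduct (allFin n) (allFin n))))
  where import Data.Nat

IsMaximumMatching : {n : ℕ} (G : Graph n) (M : Fin n → Fin n → Bool) → Set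
IsMaximumMatching G M =
  IsMatching G M × (∀ M' → IsMatching G M' → edgeCount M' Data.Nat.≤ edgeCount M)
  where import Data.Nat

Matched : {n : ℕ} → (Fin n → Fin n → Bool) → Fin n → Set
Matched M v = ∃[ u ] (M v u ≡ true)

Unmatched : {n : ℕ} → (Fin n → Fin n → Bool) → Fin n → Set
Unmatched M v = ¬ Matched M v

HasUnmatchedNbr : {n : ℕ} → Graph n → (Fin n → Fin n → Bool) → Fin n → Set
HasUnmatchedNbr G M u = ∃[ w ] (adj G u w ≡ true × Unmatched M w)

CommonUnmatchedNbr : {n : ℕ} → Graph n → (Fin n → Fin n → Bool) → Fin n → Fin n → Set
CommonUnmatchedNbr G M u v = ∃[ w ] (adj G u w ≡ true × adj G v w ≡ true × Unmatched M w)

InDG : {n : ℕ} → Graph n → (Fin n → Fin n → Bool) → (Fin n → Bool) → Set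
InDG G M D =
  -- (i) (M is symmetric, so the orientation u,v covers both cases)
  (∀ u v → M u v ≡ true →
     HasUnmatchedNbr G M u → ¬ HasUnmatchedNbr G M v → D u ≡ true)
  ×
  (∀ u v → M u v ≡ true →
     ((¬ HasUnmatchedNbr G M u × ¬ HasUnmatchedNbr G M v) ⊎ CommonUnmatchedNbr G M u v) →
     ((D u ≡ true × D v ≡ false) ⊎ (D u ≡ false × D v ≡ true)))

Dominating : {n : ℕ} → Graph n → (Fin n → Bool) → Set
Dominating G D = ∀ v → D v ≡ false → ∃[ u ] (adj G v u ≡ true × D u ≡ true)

DominatedTwice : {n : ℕ} → Graph n → (Fin n → Bool) → Fin n → Set
DominatedTwice G D v =
  ∃[ a ] ∃[ b ] (a ≢ b × adj G v a ≡ true × adj G v b ≡ true × D a ≡ true × D b ≡ true)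

-- Since M is maximum, G has no M-augmenting path of length 1 or 3.  Hence every neighbour z
-- of an unmatched vertex v is matched, say to z′, and either z′ has no unmatched neighbour
-- (so z ∈ D by rule (i)) or v is the only unmatched neighbour of z′, hence a common one of z
-- and z′ (so z or z′ lies in D by rule (ii)).  Either way each of the three neighbours z of v
-- yields a D-vertex adjacent to v that is z or the mate of z; one D-vertex can arise this way
-- from at most two distinct neighbours, so v has two neighbours in D.  For a matched edge xy
-- the same rules, together with the absence of augmenting paths of length 3, show that x ∉ D
-- forces y ∈ D.
module Submission where

open import Defs hiding (sym)
open import Data.Nat using (ℕ; suc; _≤_; _<_; _<?_)
open import Data.Nat.Properties using (n≮n; <-asym)
open import Data.Fin using (Fin; toℕ; _≟_)
open import Data.Fin.Properties using (any?; <-cmp)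
open import Data.Bool using (Bool; true; false; not; _∨_; _∧_)
open import Data.Bool.Properties using (T?; T-≡; ¬-not; not-¬) renaming (_≟_ to _≟ᵇ_)
open import Data.List using (List; []; _∷_; length; filter; allFin; cartesianProduct)
open import Data.List.Membership.Propositional using (_∈_)
open import Data.List.Membership.Propositional.Properties
  using (∈-filter⁺; ∈-filter⁻; ∈-allFin; ∈-cartesianProduct⁺)
open import Data.List.Relation.Unary.Any using (here; there)
open import Data.List.Relation.Unary.All using ([]; _∷_) renaming (lookup to lookupᴬ)
open import Data.List.Relation.Unary.AllPairs using (_∷_)
open import Data.List.Relation.Unary.Unique.Propositional using (Unique)
import Data.List.Relation.Unary.Unique.Propositional.Properties as Unique
open import Data.Product using (∃-syntax; _×_; _,_; proj₁; proj₂)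
open import Data.Sum using (_⊎_; inj₁; inj₂)
open import Data.Empty using (⊥; ⊥-elim)
open import Function using (_∘_; mk⇔; Equivalence)
open import Relation.Binary using (tri<; tri≈; tri>)
open import Relation.Nullary using (¬_; Dec; yes; no; does; contradiction)
open import Relation.Nullary.Decidable using (dec-true; dec-false; does-⇔; ¬?; _×-dec_; _⊎-dec_)
open import Relation.Binary.PropositionalEquality
  using (_≡_; _≢_; refl; sym; trans; cong; cong₂; subst; module ≡-Reasoning)

count : {A : Set} → (A → Bool) → List A → ℕ
count f xs = length (filter (λ x → T? (f x)) xs)

count-cong : {A : Set} {f g : A → Bool} (xs : List A) →
             (∀ {x} → x ∈ xs → f x ≡ g x) → count f xs ≡ count g xs
count-cong [] _ = refl
count-cong {f = f} {g} (x ∷ xs) f≗g with f x | g x | f≗g (here refl)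
... | true  | .true  | refl = cong suc (count-cong xs (f≗g ∘ there))
... | false | .false | refl = count-cong xs (f≗g ∘ there)

count-insert : {A : Set} {f g : A → Bool} {p : A} (xs : List A) → Unique xs → p ∈ xs →
               f p ≡ false → g p ≡ true → (∀ {x} → x ∈ xs → x ≢ p → f x ≡ g x) →
               count g xs ≡ suc (count f xs)
count-insert {f = f} {g} (x ∷ xs) (x∉xs ∷ _) (here refl) fp gp f≗g rewrite fp | gp =
  cong suc (sym (count-cong xs (λ x′∈xs → f≗g (there x′∈xs) λ { refl → lookupᴬ x∉xs x′∈xs refl })))
count-insert {f = f} {g} (x ∷ xs) (x∉xs ∷ xs-unique) (there p∈xs) fp gp f≗g
  with f x | g x | f≗g (here refl) (λ { refl → lookupᴬ x∉xs p∈xs refl })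
... | true  | .true  | refl = cong suc (count-insert xs xs-unique p∈xs fp gp (f≗g ∘ there))
... | false | .false | refl = count-insert xs xs-unique p∈xs fp gp (f≗g ∘ there)

SameEdge : {n : ℕ} → Fin n → Fin n → Fin n → Fin n → Set
SameEdge a b c d = (c ≡ a × d ≡ b) ⊎ (c ≡ b × d ≡ a)

sameEdge? : {n : ℕ} (a b c d : Fin n) → Dec (SameEdge a b c d)
sameEdge? a b c d = ((c ≟ a) ×-dec (d ≟ b)) ⊎-dec ((c ≟ b) ×-dec (d ≟ a))

sameEdge-swap : {n : ℕ} {a b c d : Fin n} → SameEdge a b c d → SameEdge a b d c
sameEdge-swap (inj₁ (refl , refl)) = inj₂ (refl , refl)
sameEdge-swap (inj₂ (refl , refl)) = inj₁ (refl , refl)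

sameEdge-comm : {n : ℕ} {a b c d : Fin n} → SameEdge a b c d → SameEdge b a c d
sameEdge-comm (inj₁ e) = inj₂ e
sameEdge-comm (inj₂ e) = inj₁ e

sameEdge-partner : {n : ℕ} {a b c d e : Fin n} → SameEdge a b c d → SameEdge a b c e → d ≡ e
sameEdge-partner (inj₁ (refl , refl)) (inj₁ (refl , refl)) = refl
sameEdge-partner (inj₁ (refl , refl)) (inj₂ (refl , refl)) = refl
sameEdge-partner (inj₂ (refl , refl)) (inj₁ (refl , refl)) = refl
sameEdge-partner (inj₂ (refl , refl)) (inj₂ (refl , refl)) = refl

sameEdge?-swap : {n : ℕ} (a b c d : Fin n) → does (sameEdge? a b c d) ≡ does (sameEdge? a b d c)
sameEdge?-swap a b c d =
  does-⇔ (mk⇔ sameEdge-swap sameEdge-swap) (sameEdge? a b c d) (sameEdge? a b d c)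

adjacent-sym : {n : ℕ} (G : Graph n) {a b : Fin n} → adj G a b ≡ true → adj G b a ≡ true
adjacent-sym G {a} {b} ab = trans (Graph.sym G b a) ab

adjacent⇒≢ : {n : ℕ} (G : Graph n) {a b : Fin n} → adj G a b ≡ true → a ≢ b
adjacent⇒≢ G {a} ab refl = not-¬ (irref G a) ab

module _ {n : ℕ} where

  increasing? : (p : Fin n × Fin n) → Dec (toℕ (proj₁ p) < toℕ (proj₂ p))
  increasing? p = toℕ (proj₁ p) <? toℕ (proj₂ p)

  increasingPairs : List (Fin n × Fin n)
  increasingPairs = filter increasing? (cartesianProduct (allFin n) (allFin n))

  increasingPairs-unique : Unique increasingPairs
  increasingPairs-unique =
    Unique.filter⁺ increasing? (Unique.cartesianProduct⁺ (Unique.allFin⁺ n) (Unique.allFin⁺ n))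

  increasingPairs-increasing : ∀ {c d} → (c , d) ∈ increasingPairs → toℕ c < toℕ d
  increasingPairs-increasing =
    proj₂ ∘ ∈-filter⁻ increasing? {xs = cartesianProduct (allFin n) (allFin n)}

  edgeCount-insert< : {M M′ : Fin n → Fin n → Bool} {a b : Fin n} → toℕ a < toℕ b →
                      M a b ≡ false → M′ a b ≡ true →
                      (∀ c d → ¬ SameEdge a b c d → M c d ≡ M′ c d) →
                      edgeCount M′ ≡ suc (edgeCount M)
  edgeCount-insert< {a = a} {b} a<b Mab M′ab agree =
    count-insert increasingPairs increasingPairs-unique
      (∈-filter⁺ increasing? (∈-cartesianProduct⁺ (∈-allFin a) (∈-allFin b)) a<b) Mab M′ab
      λ { {c , d} cd∈ cd≢ab → agree c d λ
          { (inj₁ (refl , refl)) → cd≢ab refl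
          ; (inj₂ (refl , refl)) → <-asym a<b (increasingPairs-increasing cd∈) } }

  edgeCount-insert : {M M′ : Fin n → Fin n → Bool} {a b : Fin n} → a ≢ b →
                     M a b ≡ false → M b a ≡ false → M′ a b ≡ true → M′ b a ≡ true →
                     (∀ c d → ¬ SameEdge a b c d → M c d ≡ M′ c d) →
                     edgeCount M′ ≡ suc (edgeCount M)
  edgeCount-insert {a = a} {b} a≢b Mab Mba M′ab M′ba agree with <-cmp a b
  ... | tri< a<b _ _ = edgeCount-insert< a<b Mab M′ab agree
  ... | tri≈ _ a≡b _ = contradiction a≡b a≢b
  ... | tri> _ _ b<a = edgeCount-insert< b<a Mba M′ba (λ c d ¬s → agree c d (¬s ∘ sameEdge-comm))

  private variable
    M : Fin n → Fin n → Bool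
    a b c d : Fin n

  -- Opaque, so that unification can recover M, a and b from an occurrence of addEdge M a b.
  opaque
    addEdge removeEdge : (Fin n → Fin n → Bool) → Fin n → Fin n → Fin n → Fin n → Bool
    addEdge    M a b c d = does (sameEdge? a b c d) ∨ M c d
    removeEdge M a b c d = not (does (sameEdge? a b c d)) ∧ M c d

    addEdge-adds : SameEdge a b c d → addEdge M a b c d ≡ true
    addEdge-adds {a} {b} {c} {d} s rewrite dec-true (sameEdge? a b c d) s = refl

    addEdge-elsewhere : ¬ SameEdge a b c d → addEdge M a b c d ≡ M c d
    addEdge-elsewhere {a} {b} {c} {d} ¬s rewrite dec-false (sameEdge? a b c d) ¬s = refl

    removeEdge-removes : SameEdge a b c d → removeEdge M a b c d ≡ false
    removeEdge-removes {a} {b} {c} {d} s rewrite dec-true (sameEdge? a b c d) s = refl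

    removeEdge-elsewhere : ¬ SameEdge a b c d → removeEdge M a b c d ≡ M c d
    removeEdge-elsewhere {a} {b} {c} {d} ¬s rewrite dec-false (sameEdge? a b c d) ¬s = refl

    addEdge-sym : (∀ c d → M c d ≡ M d c) → ∀ c d → addEdge M a b c d ≡ addEdge M a b d c
    addEdge-sym {a = a} {b} M-sym c d = cong₂ _∨_ (sameEdge?-swap a b c d) (M-sym c d)

    removeEdge-sym : (∀ c d → M c d ≡ M d c) → ∀ c d → removeEdge M a b c d ≡ removeEdge M a b d c
    removeEdge-sym {a = a} {b} M-sym c d = cong₂ _∧_ (cong not (sameEdge?-swap a b c d)) (M-sym c d)

  module _ {M : Fin n → Fin n → Bool} {a b : Fin n} where

    addEdge-true : ∀ {c d} → addEdge M a b c d ≡ true → SameEdge a b c d ⊎ M c d ≡ true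
    addEdge-true {c} {d} cd with sameEdge? a b c d
    ... | yes s = inj₁ s
    ... | no ¬s = inj₂ (trans (sym (addEdge-elsewhere ¬s)) cd)

    removeEdge-⊆ : ∀ {c d} → removeEdge M a b c d ≡ true → M c d ≡ true
    removeEdge-⊆ {c} {d} cd with sameEdge? a b c d
    ... | yes s = ⊥-elim (not-¬ (removeEdge-removes s) cd)
    ... | no ¬s = trans (sym (removeEdge-elsewhere ¬s)) cd

    unmatched-addEdge : ∀ {c} → c ≢ a → c ≢ b → Unmatched M c → Unmatched (addEdge M a b) c
    unmatched-addEdge c≢a c≢b c-free (d , cd) with addEdge-true cd
    ... | inj₁ (inj₁ (c≡a , _)) = c≢a c≡a
    ... | inj₁ (inj₂ (c≡b , _)) = c≢b c≡b
    ... | inj₂ Mcd              = c-free (d , Mcd)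

    unmatched-removeEdge : ∀ {c} → Unmatched M c → Unmatched (removeEdge M a b) c
    unmatched-removeEdge c-free (d , cd) = c-free (d , removeEdge-⊆ cd)

  module _ {G : Graph n} {M : Fin n → Fin n → Bool} (matching : IsMatching G M) where
    open IsMatching matching

    addEdge-isMatching : ∀ {a b} → adj G a b ≡ true → Unmatched M a → Unmatched M b →
                         IsMatching G (addEdge M a b)
    addEdge-isMatching {a} {b} ab a-free b-free = record
      { sub      = sub′
      ; msym     = addEdge-sym msym
      ; disjoint = disjoint′
      }
      where
        sub′ : ∀ c d → addEdge M a b c d ≡ true → adj G c d ≡ true
        sub′ c d cd with addEdge-true cd
        ... | inj₁ (inj₁ (refl , refl)) = ab
        ... | inj₁ (inj₂ (refl , refl)) = adjacent-sym G ab
        ... | inj₂ Mcd                  = sub c d Mcd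

        endpoint-free : ∀ {c d} → SameEdge a b c d → Unmatched M c
        endpoint-free (inj₁ (refl , _)) = a-free
        endpoint-free (inj₂ (refl , _)) = b-free

        disjoint′ : ∀ c d e → addEdge M a b c d ≡ true → addEdge M a b c e ≡ true → d ≡ e
        disjoint′ c d e cd ce with addEdge-true cd | addEdge-true ce
        ... | inj₁ s   | inj₁ s′  = sameEdge-partner s s′
        ... | inj₁ s   | inj₂ Mce = contradiction (e , Mce) (endpoint-free s)
        ... | inj₂ Mcd | inj₁ s′  = contradiction (d , Mcd) (endpoint-free s′)
        ... | inj₂ Mcd | inj₂ Mce = disjoint c d e Mcd Mce

    removeEdge-isMatching : ∀ {a b} → IsMatching G (removeEdge M a b)
    removeEdge-isMatching {a} {b} = record
      { sub      = λ c d → sub c d ∘ removeEdge-⊆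
      ; msym     = removeEdge-sym msym
      ; disjoint = λ c d e cd ce → disjoint c d e (removeEdge-⊆ cd) (removeEdge-⊆ ce)
      }

    sameEdge-matched : ∀ {a b c d} → M a b ≡ true → SameEdge a b c d → M c d ≡ true
    sameEdge-matched ab (inj₁ (refl , refl)) = ab
    sameEdge-matched ab (inj₂ (refl , refl)) = trans (msym _ _) ab

    removeEdge-unmatches : ∀ {a b c d} → M a b ≡ true → SameEdge a b c d →
                           Unmatched (removeEdge M a b) c
    removeEdge-unmatches {c = c} {d} ab s (e , ce)
      with disjoint c e d (removeEdge-⊆ ce) (sameEdge-matched ab s)
    ... | refl = not-¬ (removeEdge-removes s) ce

  module _ {M : Fin n → Fin n → Bool} {a b : Fin n} (a≢b : a ≢ b) where

    edgeCount-addEdge : Unmatched M a → Unmatched M b →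
                        edgeCount (addEdge M a b) ≡ suc (edgeCount M)
    edgeCount-addEdge a-free b-free =
      edgeCount-insert a≢b (unmatched⇒false a-free) (unmatched⇒false b-free)
        (addEdge-adds (inj₁ (refl , refl))) (addEdge-adds (inj₂ (refl , refl)))
        (λ c d → sym ∘ addEdge-elsewhere)
      where
        unmatched⇒false : ∀ {c d} → Unmatched M c → M c d ≡ false
        unmatched⇒false c-free = ¬-not (λ cd → c-free (_ , cd))

    edgeCount-removeEdge : M a b ≡ true → M b a ≡ true →
                           edgeCount M ≡ suc (edgeCount (removeEdge M a b))
    edgeCount-removeEdge ab ba =
      edgeCount-insert a≢b
        (removeEdge-removes (inj₁ (refl , refl))) (removeEdge-removes (inj₂ (refl , refl)))
        ab ba (λ c d → removeEdge-elsewhere)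

unmatched≢matched : {n : ℕ} {M : Fin n → Fin n → Bool} {u x y : Fin n} →
                     Unmatched M u → M x y ≡ true → u ≢ x
unmatched≢matched u-free xy refl = u-free (_ , xy)

module _ {n : ℕ} {G : Graph n} {M : Fin n → Fin n → Bool} (maximum : IsMaximumMatching G M) where
  open IsMatching (proj₁ maximum)

  no-larger-matching : ∀ {M′} → IsMatching G M′ → edgeCount M′ ≢ suc (edgeCount M)
  no-larger-matching {M′} M′-matching M′-larger =
    n≮n (edgeCount M) (subst (_≤ edgeCount M) M′-larger (proj₂ maximum M′ M′-matching))

  unmatched-nonadjacent : ∀ {v w} → Unmatched M v → Unmatched M w → adj G v w ≢ true
  unmatched-nonadjacent v-free w-free vw =
    no-larger-matching (addEdge-isMatching (proj₁ maximum) vw v-free w-free)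
                       (edgeCount-addEdge (adjacent⇒≢ G vw) v-free w-free)

  -- Flipping the augmenting path u – x ═ y – w gives the larger matching M₃.
  no-augmenting-path₃ : ∀ {u x y w} → Unmatched M u → Unmatched M w → u ≢ w →
                        adj G u x ≡ true → M x y ≡ true → adj G y w ≡ true → ⊥
  no-augmenting-path₃ {u} {x} {y} {w} u-free w-free u≢w ux xy yw =
    no-larger-matching M₃-matching M₃-larger
    where
      yx : M y x ≡ true
      yx = trans (msym y x) xy

      x≢y : x ≢ y
      x≢y = adjacent⇒≢ G (sub x y xy)

      M₁ M₂ M₃ : Fin n → Fin n → Bool
      M₁ = removeEdge M x y
      M₂ = addEdge M₁ u x
      M₃ = addEdge M₂ y w

      u-free₁ : Unmatched M₁ u
      u-free₁ = unmatched-removeEdge u-free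
      x-free₁ : Unmatched M₁ x
      x-free₁ = removeEdge-unmatches (proj₁ maximum) xy (inj₁ (refl , refl))
      y-free₂ : Unmatched M₂ y
      y-free₂ = unmatched-addEdge (unmatched≢matched {M = M} u-free yx ∘ sym) (x≢y ∘ sym)
                  (removeEdge-unmatches (proj₁ maximum) xy (inj₂ (refl , refl)))
      w-free₂ : Unmatched M₂ w
      w-free₂ = unmatched-addEdge (u≢w ∘ sym) (unmatched≢matched {M = M} w-free xy)
                  (unmatched-removeEdge w-free)

      M₃-matching : IsMatching G M₃
      M₃-matching =
        addEdge-isMatching
          (addEdge-isMatching (removeEdge-isMatching (proj₁ maximum)) ux u-free₁ x-free₁)
          yw y-free₂ w-free₂

      M₃-larger : edgeCount M₃ ≡ suc (edgeCount M)
      M₃-larger = begin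
        edgeCount M₃              ≡⟨ edgeCount-addEdge (adjacent⇒≢ G yw) y-free₂ w-free₂ ⟩
        suc (edgeCount M₂)        ≡⟨ cong suc (edgeCount-addEdge (adjacent⇒≢ G ux) u-free₁ x-free₁) ⟩
        suc (suc (edgeCount M₁))  ≡⟨ cong suc (sym (edgeCount-removeEdge x≢y xy yx)) ⟩
        suc (edgeCount M)         ∎
        where open ≡-Reasoning

neighbours : {n : ℕ} → Graph n → Fin n → List (Fin n)
neighbours {n} G v = filter (λ w → T? (adj G v w)) (allFin n)

three-distinct-members : {A : Set} (xs : List A) → Unique xs → length xs ≡ 3 →
                         ∃[ a ] ∃[ b ] ∃[ c ] (a ∈ xs × b ∈ xs × c ∈ xs × a ≢ b × a ≢ c × b ≢ c)
three-distinct-members (a ∷ b ∷ c ∷ []) ((a≢b ∷ a≢c ∷ []) ∷ (b≢c ∷ []) ∷ _) refl =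
  a , b , c , here refl , there (here refl) , there (there (here refl)) , a≢b , a≢c , b≢c

cubic⇒three-neighbours : {n : ℕ} {G : Graph n} → Cubic G → ∀ v →
  ∃[ a ] ∃[ b ] ∃[ c ]
    (adj G v a ≡ true × adj G v b ≡ true × adj G v c ≡ true × a ≢ b × a ≢ c × b ≢ c)
cubic⇒three-neighbours {n} {G} cubic v
  with three-distinct-members (neighbours G v) (Unique.filter⁺ _ (Unique.allFin⁺ n)) (cubic v)
... | a , b , c , a∈ , b∈ , c∈ , a≢b , a≢c , b≢c =
  a , b , c , nbr a∈ , nbr b∈ , nbr c∈ , a≢b , a≢c , b≢c
  where
    nbr : ∀ {w} → w ∈ neighbours G v → adj G v w ≡ true
    nbr w∈ = Equivalence.to T-≡ (proj₂ (∈-filter⁻ (λ w → T? (adj G v w)) {xs = allFin n} w∈))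

SelfOrMate : {n : ℕ} → (Fin n → Fin n → Bool) → Fin n → Fin n → Set
SelfOrMate M z t = t ≡ z ⊎ M z t ≡ true

module _ {n : ℕ} {G : Graph n} {M : Fin n → Fin n → Bool} (matching : IsMatching G M) where
  open IsMatching matching

  mate-injective : ∀ {p q t} → M p t ≡ true → M q t ≡ true → p ≡ q
  mate-injective {p} {q} {t} pt qt = disjoint t p q (trans (msym t p) pt) (trans (msym t q) qt)

  selfOrMate-of-at-most-two : ∀ {a b c t} → a ≢ b → a ≢ c → b ≢ c →
                              SelfOrMate M a t → SelfOrMate M b t → SelfOrMate M c t → ⊥
  selfOrMate-of-at-most-two a≢b a≢c b≢c (inj₁ refl) (inj₁ refl) _           = a≢b refl
  selfOrMate-of-at-most-two a≢b a≢c b≢c (inj₁ refl) (inj₂ _)    (inj₁ refl) = a≢c refl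
  selfOrMate-of-at-most-two a≢b a≢c b≢c (inj₁ _)    (inj₂ bt)   (inj₂ ct)   = b≢c (mate-injective bt ct)
  selfOrMate-of-at-most-two a≢b a≢c b≢c (inj₂ _)    (inj₁ refl) (inj₁ refl) = b≢c refl
  selfOrMate-of-at-most-two a≢b a≢c b≢c (inj₂ at)   (inj₁ _)    (inj₂ ct)   = a≢c (mate-injective at ct)
  selfOrMate-of-at-most-two a≢b a≢c b≢c (inj₂ at)   (inj₂ bt)   _           = a≢b (mate-injective at bt)

module _ {n : ℕ} {G : Graph n} {M : Fin n → Fin n → Bool} {D : Fin n → Bool}
         (maximum : IsMaximumMatching G M) (inD : InDG G M D) where
  open IsMatching (proj₁ maximum)

  private
    rule-i : ∀ u v → M u v ≡ true → HasUnmatchedNbr G M u → ¬ HasUnmatchedNbr G M v → D u ≡ true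
    rule-i = proj₁ inD

    rule-ii : ∀ u v → M u v ≡ true →
              (¬ HasUnmatchedNbr G M u × ¬ HasUnmatchedNbr G M v) ⊎ CommonUnmatchedNbr G M u v →
              (D u ≡ true × D v ≡ false) ⊎ (D u ≡ false × D v ≡ true)
    rule-ii = proj₂ inD

    matched? : ∀ v → Dec (Matched M v)
    matched? v = any? (λ u → M v u ≟ᵇ true)

    hasUnmatchedNbr? : ∀ u → Dec (HasUnmatchedNbr G M u)
    hasUnmatchedNbr? u = any? (λ w → (adj G u w ≟ᵇ true) ×-dec ¬? (matched? w))

    other-in-D : ∀ {x y} → D x ≡ false → (D x ≡ true × D y ≡ false) ⊎ (D x ≡ false × D y ≡ true) →
                 D y ≡ true
    other-in-D x∉D (inj₁ (x∈D , _)) = ⊥-elim (not-¬ x∉D x∈D)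
    other-in-D _   (inj₂ (_ , y∈D)) = y∈D


  neighbour-dominator : ∀ {v z} → Unmatched M v → adj G v z ≡ true →
                        ∃[ t ] (adj G v t ≡ true × D t ≡ true × SelfOrMate M z t)
  neighbour-dominator {v} {z} v-free vz with matched? z
  ... | no z-free = ⊥-elim (unmatched-nonadjacent maximum v-free z-free vz)
  ... | yes (z′ , zz′) with hasUnmatchedNbr? z′
  ...   | no ¬hz′ = z , vz , rule-i z z′ zz′ (v , adjacent-sym G vz , v-free) ¬hz′ , inj₁ refl
  ...   | yes (w , z′w , w-free) with w ≟ v
  ...     | no w≢v = ⊥-elim (no-augmenting-path₃ maximum v-free w-free (w≢v ∘ sym) vz zz′ z′w)
  ...     | yes refl with rule-ii z z′ zz′ (inj₂ (v , adjacent-sym G vz , z′w , v-free))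
  ...       | inj₁ (z∈D , _)  = z , vz , z∈D , inj₁ refl
  ...       | inj₂ (_ , z′∈D) = z′ , adjacent-sym G z′w , z′∈D , inj₂ zz′

  mate-in-D : ∀ {x y} → M x y ≡ true → D x ≡ false → D y ≡ true
  mate-in-D {x} {y} xy x∉D with hasUnmatchedNbr? x | hasUnmatchedNbr? y
  ... | yes hx | no ¬hy = ⊥-elim (not-¬ x∉D (rule-i x y xy hx ¬hy))
  ... | no ¬hx | yes hy = rule-i y x (trans (msym y x) xy) hy ¬hx
  ... | no ¬hx | no ¬hy = other-in-D x∉D (rule-ii x y xy (inj₁ (¬hx , ¬hy)))
  ... | yes (w₁ , xw₁ , w₁-free) | yes (w₂ , yw₂ , w₂-free) with w₁ ≟ w₂
  ...   | no w₁≢w₂ =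
    ⊥-elim (no-augmenting-path₃ maximum w₁-free w₂-free w₁≢w₂ (adjacent-sym G xw₁) xy yw₂)
  ...   | yes refl = other-in-D x∉D (rule-ii x y xy (inj₂ (w₁ , xw₁ , yw₂ , w₁-free)))

  unmatched-dominated-twice : Cubic G → ∀ {v} → Unmatched M v → DominatedTwice G D v
  unmatched-dominated-twice cubic {v} v-free with cubic⇒three-neighbours {G = G} cubic v
  ... | a , b , c , va , vb , vc , a≢b , a≢c , b≢c
    with neighbour-dominator v-free va | neighbour-dominator v-free vb | neighbour-dominator v-free vc
  ... | t₁ , vt₁ , t₁∈D , r₁ | t₂ , vt₂ , t₂∈D , r₂ | t₃ , vt₃ , t₃∈D , r₃ with t₁ ≟ t₂ | t₁ ≟ t₃
  ...   | no t₁≢t₂ | _        = t₁ , t₂ , t₁≢t₂ , vt₁ , vt₂ , t₁∈D , t₂∈D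
  ...   | yes _    | no t₁≢t₃ = t₁ , t₃ , t₁≢t₃ , vt₁ , vt₃ , t₁∈D , t₃∈D
  ...   | yes refl | yes refl =
    ⊥-elim (selfOrMate-of-at-most-two (proj₁ maximum) a≢b a≢c b≢c r₁ r₂ r₃)

  dominating : Cubic G → Dominating G D
  dominating cubic x x∉D with matched? x
  ... | yes (y , xy) = y , sub x y xy , mate-in-D xy x∉D
  ... | no x-free with unmatched-dominated-twice cubic x-free
  ...   | a , _ , _ , xa , _ , a∈D , _ = a , xa , a∈D

lemma1 : {n : ℕ} (G : Graph n) (M : Fin n → Fin n → Bool) (D : Fin n → Bool) →
         Cubic G → IsMaximumMatching G M → InDG G M D →
         Dominating G D × (∀ v → Unmatched M v → DominatedTwice G D v)
lemma1 G M D cubic maximum inD =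
  dominating maximum inD cubic , λ v → unmatched-dominated-twice maximum inD cubic
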